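{- The category $\mathbf{Inf}_{\mathrm{lin}}$ of linear information systems and linear approximable relations, equipped with the tensor product $\otimes$, unit $\mathbf{1}$, structural isomorphisms $\phi^\otimes,\sigma^\otimes,\rho^\otimes,\lambda^\otimes$, internal hom $\multimap$, linear currying $\mathrm{cur}$ and evaluation $\mathrm{ev}$ described below, is a symmetric monoidal closed category.
   Context: A linear information system (LIS) is a triple $\mathcal{A}=(A,\mathrm{Con}_A,\vdash_A)$ where $A$ is a set (of "tokens"), $\mathrm{Con}_A\subseteq\mathcal{P}_{\mathrm f}(A)$ (finite subsets) contains all singletons, and $\vdash_A\subseteq A\times A$ satisfies: (IS1) if $a\in\mathrm{Con}_A$ and every $\beta\in b$ has some $\alpha\in a$ with $\alpha\vdash_A\beta$, then $b\in\mathrm{Con}_A$; (IS2) $\alpha\vdash_A\alpha$; (IS3) $\alpha\vdash_A\beta\vdash_A\gamma$ implies $\alpha\vdash_A\gamma$. For LISs $\mathcal{A},\mathcal{B}$, a relation $R\subseteq A\times B$ is linear approximable if (AR1) whenever $a\in\mathrm{Con}_A$ and every $\beta\in b$ has some $\alpha\in a$ with $(\alpha,\beta)\in R$, then $b\in\mathrm{Con}_B$; (AR2) $\alpha'\vdash_A\alpha$, $(\alpha,\beta)\in R$, $\beta\vdash_B\beta'$ imply $(\alpha',\beta')\in R$. The category $\mathbf{Inf}_{\mathrm{lin}}$ has LISs as objects, linear approximable relations as morphisms, relational composition $R;S=\{(\alpha,\gamma):\exists\beta.\,(\alpha,\beta)\in R,(\beta,\gamma)\in S\}$, and identities $\mathrm{id}_\mathcal{A}=\vdash_A$.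 Tensor: $\mathcal{A}\otimes\mathcal{B}$ has web $A\times B$; $\{(\alpha_1,\beta_1),\dots,(\alpha_m,\beta_m)\}$ is consistent iff $\{\alpha_1,\dots,\alpha_m\}\in\mathrm{Con}_A$ and $\{\beta_1,\dots,\beta_m\}\in\mathrm{Con}_B$; $(\alpha,\beta)\vdash(\alpha',\beta')$ iff $\alpha\vdash_A\alpha'$ and $\beta\vdash_B\beta'$. On morphisms $R\otimes S=\{((\alpha,\beta),(\gamma,\delta)):(\alpha,\gamma)\in R,(\beta,\delta)\in S\}$. Unit $\mathbf{1}=(\{\ast\},\{\emptyset,\{\ast\}\},\{(\ast,\ast)\})$. Structural maps: $\phi^\otimes_{\mathcal{A},\mathcal{B},\mathcal{C}}=\{((\alpha,(\beta,\gamma)),((\alpha',\beta'),\gamma')):\alpha\vdash_A\alpha',\beta\vdash_B\beta',\gamma\vdash_C\gamma'\}$; $\sigma^\otimes_{\mathcal{A},\mathcal{B}}=\{((\alpha,\beta),(\beta',\alpha')):\alpha\vdash_A\alpha',\beta\vdash_B\beta'\}$; $\rho^\otimes_\mathcal{A}=\{((\alpha,\ast),\alpha'):\alpha\vdash_A\alpha'\}$; $\lambda^\otimes_\mathcal{A}=\{((\ast,\alpha),\alpha'):\alpha\vdash_A\alpha'\}$. Internal hom: $\mathcal{A}\multimap\mathcal{B}$ has web $A\times B$; $\{(\alpha_1,\beta_1),\dots,(\alpha_m,\beta_m)\}$ is consistent iff for every $J\subseteq[1,m]$, $\{\alpha_j:j\in J\}\in\mathrm{Con}_A$ implies $\{\beta_j:j\in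 J\}\in\mathrm{Con}_B$; $(\alpha,\beta)\vdash(\alpha',\beta')$ iff $\alpha'\vdash_A\alpha$ and $\beta\vdash_B\beta'$. Currying $\mathrm{cur}:\mathbf{Inf}_{\mathrm{lin}}(\mathcal{A}\otimes\mathcal{C},\mathcal{B})\to\mathbf{Inf}_{\mathrm{lin}}(\mathcal{C},\mathcal{A}\multimap\mathcal{B})$, $\mathrm{cur}(R)=\{(\gamma,(\alpha,\beta)):((\alpha,\gamma),\beta)\in R\}$; evaluation $\mathrm{ev}:\mathcal{A}\otimes(\mathcal{A}\multimap\mathcal{B})\to\mathcal{B}$, $\mathrm{ev}=\{((\alpha,(\alpha',\beta)),\beta'):\alpha\vdash_A\alpha',\beta\vdash_B\beta'\}$. -}

module Defs where

open import Data.List using (List; []; _∷_; map; [_])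
open import Data.List.Membership.Propositional using (_∈_)
open import Data.List.Relation.Binary.Sublist.Propositional using () renaming (_⊆_ to _⊑_)
open import Data.Product using (Σ; ∃; ∃-syntax; _×_; _,_; proj₁; proj₂)
open import Data.Unit using (⊤; tt)
open import Relation.Binary.PropositionalEquality using (_≡_)

-- Finite subsets of tokens are represented by lists; (IS1) together with
-- (IS2) forces Con to depend only on the set of elements of a list.

record PreLIS : Set₁ where
  field
    Tok : Set
    Con : List Tok → Set
    _⊢_ : Tok → Tok → Set

open PreLIS public

record IsLIS (A : PreLIS) : Set where
  field
    Con-sing : ∀ α → Con A [ α ]
    IS1 : ∀ {a b} → Con A a →
          (∀ {β} → β ∈ b → ∃[ α ] (α ∈ a × _⊢_ A α β)) → Con A b
    IS2 : ∀ α → _⊢_ A α α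
    IS3 : ∀ {α β γ} → _⊢_ A α β → _⊢_ A β γ → _⊢_ A α γ

-- a relation R ⊆ A × B (wrapped in a record so that A, B can be inferred)
record Rel (A B : PreLIS) : Set₁ where
  constructor rel
  field
    _∋_ : Tok A → Tok B → Set

open Rel public

record IsLinApprox (A B : PreLIS) (R : Rel A B) : Set where
  field
    AR1 : ∀ {a b} → Con A a →
          (∀ {β} → β ∈ b → ∃[ α ] (α ∈ a × _∋_ R α β)) → Con B b
    AR2 : ∀ {α' α β β'} → _⊢_ A α' α → _∋_ R α β → _⊢_ B β β' → _∋_ R α' β'

_≐_ : ∀ {A B} → Rel A B → Rel A B → Set
_≐_ {A} {B} R S = ∀ (α : Tok A) (β : Tok B) →
  (_∋_ R α β → _∋_ S α β) × (_∋_ S α β → _∋_ R α β)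

infix 4 _≐_

_⨾_ : ∀ {A B C} → Rel A B → Rel B C → Rel A C
_⨾_ {B = B} R S = rel λ α γ → ∃[ β ] (_∋_ R α β × _∋_ S β γ)

infixl 6 _⨾_

idR : ∀ A → Rel A A
idR A = rel (_⊢_ A)

_⊗_ : PreLIS → PreLIS → PreLIS
A ⊗ B = record
  { Tok = Tok A × Tok B
  ; Con = λ xs → Con A (map proj₁ xs) × Con B (map proj₂ xs)
  ; _⊢_ = λ p q → _⊢_ A (proj₁ p) (proj₁ q) × _⊢_ B (proj₂ p) (proj₂ q)
  }

infixr 7 _⊗_

_⊗ᵣ_ : ∀ {A B C D} → Rel A C → Rel B D → Rel (A ⊗ B) (C ⊗ D)
R ⊗ᵣ S = rel λ p q → _∋_ R (proj₁ p) (proj₁ q) × _∋_ S (proj₂ p) (proj₂ q)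

infixr 7 _⊗ᵣ_

-- unit: one token *, Con = {∅, {*}} (any list of copies of *), * ⊢ *
𝟙 : PreLIS
𝟙 = record { Tok = ⊤ ; Con = λ _ → ⊤ ; _⊢_ = λ _ _ → ⊤ }

φ : ∀ A B C → Rel (A ⊗ (B ⊗ C)) ((A ⊗ B) ⊗ C)
φ A B C = rel λ { (α , (β , γ)) ((α' , β') , γ') →
  _⊢_ A α α' × _⊢_ B β β' × _⊢_ C γ γ' }

σ : ∀ A B → Rel (A ⊗ B) (B ⊗ A)
σ A B = rel λ { (α , β) (β' , α') → _⊢_ A α α' × _⊢_ B β β' }

ρ : ∀ A → Rel (A ⊗ 𝟙) A
ρ A = rel λ { (α , _) α' → _⊢_ A α α' }

λ⊗ : ∀ A → Rel (𝟙 ⊗ A) A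
λ⊗ A = rel λ { (_ , α) α' → _⊢_ A α α' }

_⊸_ : PreLIS → PreLIS → PreLIS
A ⊸ B = record
  { Tok = Tok A × Tok B
  ; Con = λ xs → ∀ ys → ys ⊑ xs → Con A (map proj₁ ys) → Con B (map proj₂ ys)
  ; _⊢_ = λ p q → _⊢_ A (proj₁ q) (proj₁ p) × _⊢_ B (proj₂ p) (proj₂ q)
  }

infixr 6 _⊸_

cur : ∀ {A B C} → Rel (A ⊗ C) B → Rel C (A ⊸ B)
cur R = rel λ { γ (α , β) → _∋_ R (α , γ) β }

ev : ∀ A B → Rel (A ⊗ (A ⊸ B)) B
ev A B = rel λ { (α , (α' , β)) β' → _⊢_ A α α' × _⊢_ B β β' }

IsIso : ∀ A B → Rel A B → Set₁
IsIso A B R = Σ (Rel B A) λ S →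
  IsLinApprox B A S × (R ⨾ S ≐ idR A) × (S ⨾ R ≐ idR B)

record InfLinIsSMCC : Set₁ where
  field
    id-mor   : ∀ {A} → IsLIS A → IsLinApprox A A (idR A)
    comp-mor : ∀ {A B C} {R : Rel A B} {S : Rel B C} →
               IsLIS A → IsLIS B → IsLIS C →
               IsLinApprox A B R → IsLinApprox B C S → IsLinApprox A C (R ⨾ S)
    idˡ      : ∀ {A B} {R : Rel A B} → IsLIS A → IsLIS B →
               IsLinApprox A B R → idR A ⨾ R ≐ R
    idʳ      : ∀ {A B} {R : Rel A B} → IsLIS A → IsLIS B →
               IsLinApprox A B R → R ⨾ idR B ≐ R
    assoc    : ∀ {A B C D} {R : Rel A B} {S : Rel B C} {T : Rel C D} →
               IsLIS A → IsLIS B → IsLIS C → IsLIS D →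
               IsLinApprox A B R → IsLinApprox B C S → IsLinApprox C D T →
               (R ⨾ S) ⨾ T ≐ R ⨾ (S ⨾ T)
    ⊗-LIS    : ∀ {A B} → IsLIS A → IsLIS B → IsLIS (A ⊗ B)
    𝟙-LIS    : IsLIS 𝟙
    ⊗-mor    : ∀ {A B C D} {R : Rel A C} {S : Rel B D} →
               IsLIS A → IsLIS B → IsLIS C → IsLIS D →
               IsLinApprox A C R → IsLinApprox B D S →
               IsLinApprox (A ⊗ B) (C ⊗ D) (R ⊗ᵣ S)
    ⊗-id     : ∀ {A B} → IsLIS A → IsLIS B →
               _⊗ᵣ_ {A} {B} {A} {B} (idR A) (idR B) ≐ idR (A ⊗ B)
    ⊗-comp   : ∀ {A B C A' B' C'} {R : Rel A B} {R' : Rel B C}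
                 {S : Rel A' B'} {S' : Rel B' C'} →
               IsLIS A → IsLIS B → IsLIS C → IsLIS A' → IsLIS B' → IsLIS C' →
               IsLinApprox A B R → IsLinApprox B C R' →
               IsLinApprox A' B' S → IsLinApprox B' C' S' →
               _⊗ᵣ_ {A} {A'} {C} {C'} (R ⨾ R') (S ⨾ S')
                 ≐ _⨾_ {B = B ⊗ B'} (R ⊗ᵣ S) (R' ⊗ᵣ S')
    φ-mor    : ∀ {A B C} → IsLIS A → IsLIS B → IsLIS C →
               IsLinApprox (A ⊗ (B ⊗ C)) ((A ⊗ B) ⊗ C) (φ A B C)
    φ-iso    : ∀ {A B C} → IsLIS A → IsLIS B → IsLIS C →
               IsIso (A ⊗ (B ⊗ C)) ((A ⊗ B) ⊗ C) (φ A B C)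
    σ-mor    : ∀ {A B} → IsLIS A → IsLIS B → IsLinApprox (A ⊗ B) (B ⊗ A) (σ A B)
    σ-iso    : ∀ {A B} → IsLIS A → IsLIS B → IsIso (A ⊗ B) (B ⊗ A) (σ A B)
    ρ-mor    : ∀ {A} → IsLIS A → IsLinApprox (A ⊗ 𝟙) A (ρ A)
    ρ-iso    : ∀ {A} → IsLIS A → IsIso (A ⊗ 𝟙) A (ρ A)
    λ-mor    : ∀ {A} → IsLIS A → IsLinApprox (𝟙 ⊗ A) A (λ⊗ A)
    λ-iso    : ∀ {A} → IsLIS A → IsIso (𝟙 ⊗ A) A (λ⊗ A)
    φ-nat    : ∀ {A B C A' B' C'} {R : Rel A A'} {S : Rel B B'} {T : Rel C C'} →
               IsLIS A → IsLIS B → IsLIS C → IsLIS A' → IsLIS B' → IsLIS C' →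
               IsLinApprox A A' R → IsLinApprox B B' S → IsLinApprox C C' T →
               _⨾_ {B = (A ⊗ B) ⊗ C} (φ A B C) ((R ⊗ᵣ S) ⊗ᵣ T)
                 ≐ _⨾_ {B = A' ⊗ (B' ⊗ C')} (R ⊗ᵣ (S ⊗ᵣ T)) (φ A' B' C')
    σ-nat    : ∀ {A B A' B'} {R : Rel A A'} {S : Rel B B'} →
               IsLIS A → IsLIS B → IsLIS A' → IsLIS B' →
               IsLinApprox A A' R → IsLinApprox B B' S →
               _⨾_ {B = B ⊗ A} (σ A B) (S ⊗ᵣ R)
                 ≐ _⨾_ {B = A' ⊗ B'} (R ⊗ᵣ S) (σ A' B')
    ρ-nat    : ∀ {A A'} {R : Rel A A'} → IsLIS A → IsLIS A' →
               IsLinApprox A A' R →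
               _⨾_ {B = A} (ρ A) R
                 ≐ _⨾_ {B = A' ⊗ 𝟙} (_⊗ᵣ_ {A} {𝟙} {A'} {𝟙} R (idR 𝟙)) (ρ A')
    λ-nat    : ∀ {A A'} {R : Rel A A'} → IsLIS A → IsLIS A' →
               IsLinApprox A A' R →
               _⨾_ {B = A} (λ⊗ A) R
                 ≐ _⨾_ {B = 𝟙 ⊗ A'} (_⊗ᵣ_ {𝟙} {A} {𝟙} {A'} (idR 𝟙) R) (λ⊗ A')
    pentagon : ∀ {A B C D} → IsLIS A → IsLIS B → IsLIS C → IsLIS D →
               _⨾_ {B = (A ⊗ B) ⊗ (C ⊗ D)} (φ A B (C ⊗ D)) (φ (A ⊗ B) C D)
                 ≐ _⨾_ {B = (A ⊗ (B ⊗ C)) ⊗ D}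
                     (_⨾_ {B = A ⊗ ((B ⊗ C) ⊗ D)}
                        (_⊗ᵣ_ {A} {B ⊗ (C ⊗ D)} {A} {(B ⊗ C) ⊗ D}
                           (idR A) (φ B C D))
                        (φ A (B ⊗ C) D))
                     (_⊗ᵣ_ {A ⊗ (B ⊗ C)} {D} {(A ⊗ B) ⊗ C} {D}
                        (φ A B C) (idR D))
    triangle : ∀ {A B} → IsLIS A → IsLIS B →
               _⊗ᵣ_ {A} {𝟙 ⊗ B} {A} {B} (idR A) (λ⊗ B)
                 ≐ _⨾_ {B = (A ⊗ 𝟙) ⊗ B} (φ A 𝟙 B)
                     (_⊗ᵣ_ {A ⊗ 𝟙} {B} {A} {B} (ρ A) (idR B))
    hexagon  : ∀ {A B C} → IsLIS A → IsLIS B → IsLIS C →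
               _⨾_ {B = C ⊗ (A ⊗ B)}
                 (_⨾_ {B = (A ⊗ B) ⊗ C} (φ A B C) (σ (A ⊗ B) C))
                 (φ C A B)
                 ≐ _⨾_ {B = (A ⊗ C) ⊗ B}
                     (_⨾_ {B = A ⊗ (C ⊗ B)}
                        (_⊗ᵣ_ {A} {B ⊗ C} {A} {C ⊗ B} (idR A) (σ B C))
                        (φ A C B))
                     (_⊗ᵣ_ {A ⊗ C} {B} {C ⊗ A} {B} (σ A C) (idR B))
    symmetry : ∀ {A B} → IsLIS A → IsLIS B →
               _⨾_ {B = B ⊗ A} (σ A B) (σ B A) ≐ idR (A ⊗ B)
    ⊸-LIS    : ∀ {A B} → IsLIS A → IsLIS B → IsLIS (A ⊸ B)
    ev-mor   : ∀ {A B} → IsLIS A → IsLIS B →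
               IsLinApprox (A ⊗ (A ⊸ B)) B (ev A B)
    cur-mor  : ∀ {A B C} {R : Rel (A ⊗ C) B} → IsLIS A → IsLIS B → IsLIS C →
               IsLinApprox (A ⊗ C) B R → IsLinApprox C (A ⊸ B) (cur {A} {B} {C} R)
    cur-β    : ∀ {A B C} {R : Rel (A ⊗ C) B} → IsLIS A → IsLIS B → IsLIS C →
               IsLinApprox (A ⊗ C) B R →
               _⨾_ {B = A ⊗ (A ⊸ B)}
                 (_⊗ᵣ_ {A} {C} {A} {A ⊸ B} (idR A) (cur {A} {B} {C} R)) (ev A B)
                 ≐ R
    cur-uniq : ∀ {A B C} {R : Rel (A ⊗ C) B} {H : Rel C (A ⊸ B)} →
               IsLIS A → IsLIS B → IsLIS C →
               IsLinApprox (A ⊗ C) B R → IsLinApprox C (A ⊸ B) H →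
               _⨾_ {B = A ⊗ (A ⊸ B)} (_⊗ᵣ_ {A} {C} {A} {A ⊸ B} (idR A) H) (ev A B)
                 ≐ R →
               H ≐ cur {A} {B} {C} R

-- Every law is an equation between relations, checked pointwise from
-- reflexivity and transitivity of entailment and the closure property (AR2)
-- of the morphisms involved. The content lies in the consistency conditions.
-- (IS1) and (AR1) both say that consistency is preserved along coverings of
-- one finite set by another, and this is stable under pairing and projection,
-- which handles ⊗ and the structural maps. For ⊸ and ev, a consistent set of
-- the function space is applied to consistent arguments by pruning it to the
-- pairs that actually fire; for cur R one chooses witnesses in R for each of
-- the finitely many outputs.

module Submission where

open import Defs
open import Data.List using (List; []; _∷_; map; [_])
open import Data.List.Membership.Propositional using (_∈_)
open import Data.List.Membership.Propositional.Properties using (∈-map⁺; ∈-map⁻)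
open import Data.List.Relation.Unary.Any using (here; there)
open import Data.List.Relation.Binary.Sublist.Propositional
  using ([]; _∷_; _∷ʳ_; minimum; lookup) renaming (_⊆_ to _⊑_)
open import Data.List.Relation.Binary.Subset.Propositional using (_⊆_)
open import Data.List.Relation.Binary.Subset.Propositional.Properties
  using (⊆-trans; xs⊆x∷xs; ∷⁺ʳ; ∈-∷⁺ʳ)
open import Data.Product using (Σ; ∃-syntax; _×_; _,_; proj₁; proj₂)
open import Data.Unit using (⊤; tt)
open import Function using (_∘_; id; flip)
open import Relation.Binary.PropositionalEquality using (refl)

open IsLIS
open IsLinApprox

Covers : {X Y : Set} → (X → Y → Set) → List X → List Y → Set
Covers W xs ys = ∀ {y} → y ∈ ys → ∃[ x ] (x ∈ xs × W x y)

module _ {X Y : Set} {W : X → Y → Set} where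

  Covers-∷ : ∀ {x y xs ys} → x ∈ xs → W x y → Covers W xs ys → Covers W xs (y ∷ ys)
  Covers-∷ x∈ w cov (here refl) = _ , x∈ , w
  Covers-∷ x∈ w cov (there y∈) = cov y∈

  Covers-⊆ : ∀ {xs xs′ ys} → xs ⊆ xs′ → Covers W xs ys → Covers W xs′ ys
  Covers-⊆ xs⊆ cov y∈ = let (x , x∈ , w) = cov y∈ in x , xs⊆ x∈ , w

  Covers-mono : ∀ {V : X → Y → Set} {xs ys} →
                (∀ {x y} → V x y → W x y) → Covers V xs ys → Covers W xs ys
  Covers-mono V⇒W cov y∈ = let (x , x∈ , v) = cov y∈ in x , x∈ , V⇒W v

  Covers-mapˡ : ∀ {X′ : Set} (f : X′ → X) {xs ys} →
                Covers (W ∘ f) xs ys → Covers W (map f xs) ys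
  Covers-mapˡ f cov y∈ = let (x , x∈ , w) = cov y∈ in f x , ∈-map⁺ f x∈ , w

  Covers-mapʳ : ∀ {Y′ : Set} (g : Y′ → Y) {xs ys} →
                Covers (λ x y → W x (g y)) xs ys → Covers W xs (map g ys)
  Covers-mapʳ g cov gy∈ with ∈-map⁻ g gy∈
  ... | _ , y∈ , refl = cov y∈

Covers-choice : ∀ {Y Q : Set} {P : Y → Q → Set} (ys : List Y) →
                (∀ {y} → y ∈ ys → Σ Q (P y)) →
                ∃[ qs ] (Covers P ys qs × Covers (flip P) qs ys)
Covers-choice [] _ = [] , (λ ()) , (λ ())
Covers-choice (y ∷ ys) choose =
  let (q , p) = choose (here refl)
      (qs , qs-from , qs-to) = Covers-choice ys (choose ∘ there)
  in q ∷ qs , Covers-∷ (here refl) p (Covers-⊆ (xs⊆x∷xs ys y) qs-from)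
            , Covers-∷ (here refl) p (Covers-⊆ (xs⊆x∷xs qs q) qs-to)

Covers-factor : ∀ {X Y Z : Set} {V : X → Y → Set} {W : Y → Z → Set} {xs zs} →
                Covers (λ x z → ∃[ y ] (V x y × W y z)) xs zs →
                ∃[ ys ] (Covers V xs ys × Covers W ys zs)
Covers-factor {V = V} {W} {xs} {zs} cov =
  let (ys , ys-from , ys-to) =
        Covers-choice {P = λ z y → (∃[ x ] (x ∈ xs × V x y)) × W y z} zs
          (λ z∈ → let (x , x∈ , y , v , w) = cov z∈ in y , (x , x∈ , v) , w)
  in ys , (λ y∈ → let (_ , _ , x-below , _) = ys-from y∈ in x-below) , Covers-mono proj₂ ys-to

⊑-insert : ∀ {X : Set} {x : X} {ws xs} → ws ⊑ xs → x ∈ xs →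
           ∃[ vs ] (vs ⊑ xs × x ∈ vs × ws ⊆ vs × vs ⊆ x ∷ ws)
⊑-insert (y ∷ʳ τ) (here refl) = _ , refl ∷ τ , here refl , there , id
⊑-insert (y ∷ʳ τ) (there x∈) = let (vs , τ′ , rest) = ⊑-insert τ x∈ in vs , y ∷ʳ τ′ , rest
⊑-insert (refl ∷ τ) (here refl) = _ , refl ∷ τ , here refl , id , there
⊑-insert {x = x} {ws = y ∷ ws} (refl ∷ τ) (there x∈) =
  let (vs , τ′ , x∈vs , ws⊆vs , vs⊆x∷ws) = ⊑-insert τ x∈
  in y ∷ vs , refl ∷ τ′ , there x∈vs , ∷⁺ʳ y ws⊆vs
   , ∈-∷⁺ʳ (there (here refl)) (⊆-trans vs⊆x∷ws (∷⁺ʳ x (xs⊆x∷xs ws y)))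

Covers-prune : ∀ {X Y : Set} {W : X → Y → Set} (xs : List X) (ys : List Y) →
               Covers W xs ys → ∃[ ws ] (ws ⊑ xs × Covers W ws ys × Covers (flip W) ys ws)
Covers-prune xs [] _ = [] , minimum xs , (λ ()) , (λ ())
Covers-prune xs (y ∷ ys) cov =
  let (x , x∈xs , w) = cov (here refl)
      (ws , τ , ys-covered , ws-used) = Covers-prune xs ys (cov ∘ there)
      (vs , τ′ , x∈vs , ws⊆vs , vs⊆x∷ws) = ⊑-insert τ x∈xs
  in vs , τ′ , Covers-∷ x∈vs w (Covers-⊆ ws⊆vs ys-covered)
   , λ v∈ → Covers-∷ (here refl) w (Covers-⊆ (xs⊆x∷xs ys y) ws-used) (vs⊆x∷ws v∈)

-- The common shape of (IS1) and (AR1); a record rather than a type synonym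
-- so that its indices can be inferred.
record PreservesCon (A B : PreLIS) (W : Tok A → Tok B → Set) : Set where
  constructor preservesCon
  field preserve : ∀ {a b} → Con A a → Covers W a b → Con B b

open PreservesCon

module _ {A B : PreLIS} {W : Tok A → Tok B → Set} where

  preservesCon-mono : ∀ {V : Tok A → Tok B → Set} →
                      PreservesCon A B W → (∀ {x y} → V x y → W x y) → PreservesCon A B V
  preservesCon-mono pres V⇒W = preservesCon λ c cov → preserve pres c (Covers-mono V⇒W cov)

  preservesCon-π₁ : ∀ C → PreservesCon A B W → PreservesCon (A ⊗ C) B (W ∘ proj₁)
  preservesCon-π₁ _ pres = preservesCon λ (c , _) cov → preserve pres c (Covers-mapˡ proj₁ cov)

  preservesCon-π₂ : ∀ C → PreservesCon A B W → PreservesCon (C ⊗ A) B (W ∘ proj₂)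
  preservesCon-π₂ _ pres = preservesCon λ (_ , c) cov → preserve pres c (Covers-mapˡ proj₂ cov)

preservesCon-⟨,⟩ : ∀ {X A B} {V : Tok X → Tok A → Set} {W : Tok X → Tok B → Set} →
                   PreservesCon X A V → PreservesCon X B W →
                   PreservesCon X (A ⊗ B) (λ x p → V x (proj₁ p) × W x (proj₂ p))
preservesCon-⟨,⟩ presV presW = preservesCon λ c cov →
  preserve presV c (Covers-mapʳ proj₁ (Covers-mono proj₁ cov)) ,
  preserve presW c (Covers-mapʳ proj₂ (Covers-mono proj₂ cov))

preservesCon-⊗ : ∀ {A B C D} {V : Tok A → Tok C → Set} {W : Tok B → Tok D → Set} →
                 PreservesCon A C V → PreservesCon B D W →
                 PreservesCon (A ⊗ B) (C ⊗ D)
                   (λ p q → V (proj₁ p) (proj₁ q) × W (proj₂ p) (proj₂ q))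
preservesCon-⊗ {A} {B} presV presW =
  preservesCon-⟨,⟩ (preservesCon-π₁ B presV) (preservesCon-π₂ A presW)

preservesCon-𝟙 : ∀ {A} {W : Tok A → ⊤ → Set} → PreservesCon A 𝟙 W
preservesCon-𝟙 = preservesCon λ _ _ → tt

IS1-preservesCon : ∀ {A} → IsLIS A → PreservesCon A A (_⊢_ A)
IS1-preservesCon LA = preservesCon (IS1 LA)

AR1-preservesCon : ∀ {A B} {R : Rel A B} → IsLinApprox A B R → PreservesCon A B (_∋_ R)
AR1-preservesCon r = preservesCon (AR1 r)

idR-isLinApprox : ∀ {A} → IsLIS A → IsLinApprox A A (idR A)
idR-isLinApprox LA = record
  { AR1 = IS1 LA
  ; AR2 = λ p q r → IS3 LA (IS3 LA p q) r }

⨾-isLinApprox : ∀ {A B C} {R : Rel A B} {S : Rel B C} → IsLIS B →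
                IsLinApprox A B R → IsLinApprox B C S → IsLinApprox A C (R ⨾ S)
⨾-isLinApprox LB r s = record
  { AR1 = λ c cov → let (bs , R-cov , S-cov) = Covers-factor cov in AR1 s (AR1 r c R-cov) S-cov
  ; AR2 = λ p (β , rb , sb) q → β , AR2 r p rb (IS2 LB β) , AR2 s (IS2 LB β) sb q }

module _ {A B} {R : Rel A B} (LA : IsLIS A) (LB : IsLIS B) (r : IsLinApprox A B R) where

  ⨾-identityˡ : idR A ⨾ R ≐ R
  ⨾-identityˡ α β = (λ (_ , p , q) → AR2 r p q (IS2 LB β)) , (λ q → α , IS2 LA α , q)

  ⨾-identityʳ : R ⨾ idR B ≐ R
  ⨾-identityʳ α β = (λ (_ , q , p) → AR2 r (IS2 LA α) q p) , (λ q → β , q , IS2 LB β)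

⨾-assoc : ∀ {A B C D} (R : Rel A B) (S : Rel B C) (T : Rel C D) → (R ⨾ S) ⨾ T ≐ R ⨾ (S ⨾ T)
⨾-assoc R S T α δ =
  (λ (γ , (β , r , s) , t) → β , r , γ , s , t) ,
  (λ (β , r , γ , s , t) → γ , (β , r , s) , t)

⊗-isLIS : ∀ {A B} → IsLIS A → IsLIS B → IsLIS (A ⊗ B)
⊗-isLIS LA LB = record
  { Con-sing = λ (α , β) → Con-sing LA α , Con-sing LB β
  ; IS1 = preserve (preservesCon-⊗ (IS1-preservesCon LA) (IS1-preservesCon LB))
  ; IS2 = λ (α , β) → IS2 LA α , IS2 LB β
  ; IS3 = λ (p , q) (p′ , q′) → IS3 LA p p′ , IS3 LB q q′ }

𝟙-isLIS : IsLIS 𝟙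
𝟙-isLIS = record { Con-sing = λ _ → tt ; IS1 = λ _ _ → tt ; IS2 = λ _ → tt ; IS3 = λ _ _ → tt }

⊗ᵣ-isLinApprox : ∀ {A B C D} {R : Rel A C} {S : Rel B D} →
                 IsLinApprox A C R → IsLinApprox B D S → IsLinApprox (A ⊗ B) (C ⊗ D) (R ⊗ᵣ S)
⊗ᵣ-isLinApprox r s = record
  { AR1 = preserve (preservesCon-⊗ (AR1-preservesCon r) (AR1-preservesCon s))
  ; AR2 = λ (p , q) (r′ , s′) (p′ , q′) → AR2 r p r′ p′ , AR2 s q s′ q′ }

⊗ᵣ-identity : ∀ A B → _⊗ᵣ_ {A} {B} (idR A) (idR B) ≐ idR (A ⊗ B)
⊗ᵣ-identity A B _ _ = id , id

⊗ᵣ-⨾ : ∀ {A B C A′ B′ C′} (R : Rel A B) (R′ : Rel B C) (S : Rel A′ B′) (S′ : Rel B′ C′) →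
       _⊗ᵣ_ {A} {A′} (R ⨾ R′) (S ⨾ S′) ≐ _⨾_ {B = B ⊗ B′} (R ⊗ᵣ S) (R′ ⊗ᵣ S′)
⊗ᵣ-⨾ R R′ S S′ _ _ =
  (λ ((β , r , r′) , (β′ , s , s′)) → (β , β′) , (r , s) , (r′ , s′)) ,
  (λ ((β , β′) , (r , s) , (r′ , s′)) → (β , r , r′) , (β′ , s , s′))

φ⁻¹ : ∀ A B C → Rel ((A ⊗ B) ⊗ C) (A ⊗ (B ⊗ C))
φ⁻¹ A B C = rel λ { ((α , β) , γ) (α′ , (β′ , γ′)) → _⊢_ A α α′ × _⊢_ B β β′ × _⊢_ C γ γ′ }

module _ {A B C} (LA : IsLIS A) (LB : IsLIS B) (LC : IsLIS C) where

  φ-isLinApprox : IsLinApprox (A ⊗ (B ⊗ C)) ((A ⊗ B) ⊗ C) (φ A B C)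
  φ-isLinApprox = record
    { AR1 = preserve (preservesCon-mono
        (preservesCon-⟨,⟩
          (preservesCon-⟨,⟩ (preservesCon-π₁ (B ⊗ C) (IS1-preservesCon LA))
                            (preservesCon-π₂ A (preservesCon-π₁ C (IS1-preservesCon LB))))
          (preservesCon-π₂ A (preservesCon-π₂ B (IS1-preservesCon LC))))
        λ (a , b , c) → (a , b) , c)
    ; AR2 = λ (a , b , c) (a′ , b′ , c′) ((a″ , b″) , c″) →
        IS3 LA a (IS3 LA a′ a″) , IS3 LB b (IS3 LB b′ b″) , IS3 LC c (IS3 LC c′ c″) }

  φ⁻¹-isLinApprox : IsLinApprox ((A ⊗ B) ⊗ C) (A ⊗ (B ⊗ C)) (φ⁻¹ A B C)
  φ⁻¹-isLinApprox = record
    { AR1 = preserve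
        (preservesCon-⟨,⟩
          (preservesCon-π₁ C (preservesCon-π₁ B (IS1-preservesCon LA)))
          (preservesCon-⟨,⟩ (preservesCon-π₁ C (preservesCon-π₂ A (IS1-preservesCon LB)))
                            (preservesCon-π₂ (A ⊗ B) (IS1-preservesCon LC))))
    ; AR2 = λ ((a , b) , c) (a′ , b′ , c′) (a″ , b″ , c″) →
        IS3 LA a (IS3 LA a′ a″) , IS3 LB b (IS3 LB b′ b″) , IS3 LC c (IS3 LC c′ c″) }

  φ-isIso : IsIso (A ⊗ (B ⊗ C)) ((A ⊗ B) ⊗ C) (φ A B C)
  φ-isIso = φ⁻¹ A B C , φ⁻¹-isLinApprox ,
    (λ (α , (β , γ)) _ →
      (λ (_ , (a , b , c) , (a′ , b′ , c′)) → IS3 LA a a′ , IS3 LB b b′ , IS3 LC c c′) ,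
      (λ (a , b , c) → ((α , β) , γ) , (IS2 LA α , IS2 LB β , IS2 LC γ) , (a , b , c))) ,
    (λ ((α , β) , γ) _ →
      (λ (_ , (a , b , c) , (a′ , b′ , c′)) → (IS3 LA a a′ , IS3 LB b b′) , IS3 LC c c′) ,
      (λ ((a , b) , c) → (α , (β , γ)) , (IS2 LA α , IS2 LB β , IS2 LC γ) , (a , b , c)))

module _ {A B} (LA : IsLIS A) (LB : IsLIS B) where

  σ-isLinApprox : IsLinApprox (A ⊗ B) (B ⊗ A) (σ A B)
  σ-isLinApprox = record
    { AR1 = preserve (preservesCon-mono
        (preservesCon-⟨,⟩ (preservesCon-π₂ A (IS1-preservesCon LB))
                          (preservesCon-π₁ B (IS1-preservesCon LA)))
        λ (a , b) → b , a)
    ; AR2 = λ (a , b) (a′ , b′) (b″ , a″) → IS3 LA a (IS3 LA a′ a″) , IS3 LB b (IS3 LB b′ b″) }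

  σ-involutive : _⨾_ {B = B ⊗ A} (σ A B) (σ B A) ≐ idR (A ⊗ B)
  σ-involutive (α , β) _ =
    (λ (_ , (a , b) , (b′ , a′)) → IS3 LA a a′ , IS3 LB b b′) ,
    (λ (a , b) → (β , α) , (IS2 LA α , IS2 LB β) , (b , a))

σ-isIso : ∀ {A B} → IsLIS A → IsLIS B → IsIso (A ⊗ B) (B ⊗ A) (σ A B)
σ-isIso {A} {B} LA LB = σ B A , σ-isLinApprox LB LA , σ-involutive LA LB , σ-involutive LB LA

ρ⁻¹ : ∀ A → Rel A (A ⊗ 𝟙)
ρ⁻¹ A = rel λ { α (α′ , _) → _⊢_ A α α′ }

λ⊗⁻¹ : ∀ A → Rel A (𝟙 ⊗ A)
λ⊗⁻¹ A = rel λ { α (_ , α′) → _⊢_ A α α′ }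

module _ {A} (LA : IsLIS A) where

  ρ-isLinApprox : IsLinApprox (A ⊗ 𝟙) A (ρ A)
  ρ-isLinApprox = record
    { AR1 = preserve (preservesCon-π₁ 𝟙 (IS1-preservesCon LA))
    ; AR2 = λ (a , _) a′ a″ → IS3 LA a (IS3 LA a′ a″) }

  ρ-isIso : IsIso (A ⊗ 𝟙) A (ρ A)
  ρ-isIso = ρ⁻¹ A ,
    record
      { AR1 = preserve (preservesCon-mono
          (preservesCon-⟨,⟩ (IS1-preservesCon LA) (preservesCon-𝟙 {W = λ _ _ → ⊤})) (λ a → a , tt))
      ; AR2 = λ a a′ (a″ , _) → IS3 LA a (IS3 LA a′ a″) } ,
    (λ (α , _) _ → (λ (_ , a , a′) → IS3 LA a a′ , tt) , (λ (a , _) → α , IS2 LA α , a)) ,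
    (λ α _ → (λ (_ , a , a′) → IS3 LA a a′) , (λ a → (α , tt) , IS2 LA α , a))

  λ-isLinApprox : IsLinApprox (𝟙 ⊗ A) A (λ⊗ A)
  λ-isLinApprox = record
    { AR1 = preserve (preservesCon-π₂ 𝟙 (IS1-preservesCon LA))
    ; AR2 = λ (_ , a) a′ a″ → IS3 LA a (IS3 LA a′ a″) }

  λ-isIso : IsIso (𝟙 ⊗ A) A (λ⊗ A)
  λ-isIso = λ⊗⁻¹ A ,
    record
      { AR1 = preserve (preservesCon-mono
          (preservesCon-⟨,⟩ (preservesCon-𝟙 {W = λ _ _ → ⊤}) (IS1-preservesCon LA)) (λ a → tt , a))
      ; AR2 = λ a a′ (_ , a″) → IS3 LA a (IS3 LA a′ a″) } ,
    (λ (_ , α) _ → (λ (_ , a , a′) → tt , IS3 LA a a′) , (λ (_ , a) → α , IS2 LA α , a)) ,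
    (λ α _ → (λ (_ , a , a′) → IS3 LA a a′) , (λ a → (tt , α) , IS2 LA α , a))

module _ {A B C A′ B′ C′} {R : Rel A A′} {S : Rel B B′} {T : Rel C C′}
         (LA : IsLIS A) (LB : IsLIS B) (LC : IsLIS C)
         (LA′ : IsLIS A′) (LB′ : IsLIS B′) (LC′ : IsLIS C′)
         (r : IsLinApprox A A′ R) (s : IsLinApprox B B′ S) (t : IsLinApprox C C′ T) where

  φ-natural : _⨾_ {B = (A ⊗ B) ⊗ C} (φ A B C) ((R ⊗ᵣ S) ⊗ᵣ T)
                ≐ _⨾_ {B = A′ ⊗ (B′ ⊗ C′)} (R ⊗ᵣ (S ⊗ᵣ T)) (φ A′ B′ C′)
  φ-natural (α , (β , γ)) ((α″ , β″) , γ″) =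
    (λ (_ , (a , b , c) , ((r′ , s′) , t′)) →
      (α″ , (β″ , γ″)) ,
      (AR2 r a r′ (IS2 LA′ α″) , AR2 s b s′ (IS2 LB′ β″) , AR2 t c t′ (IS2 LC′ γ″)) ,
      (IS2 LA′ α″ , IS2 LB′ β″ , IS2 LC′ γ″)) ,
    (λ (_ , (r′ , s′ , t′) , (a , b , c)) →
      ((α , β) , γ) , (IS2 LA α , IS2 LB β , IS2 LC γ) ,
      ((AR2 r (IS2 LA α) r′ a , AR2 s (IS2 LB β) s′ b) , AR2 t (IS2 LC γ) t′ c))

module _ {A B A′ B′} {R : Rel A A′} {S : Rel B B′}
         (LA : IsLIS A) (LB : IsLIS B) (LA′ : IsLIS A′) (LB′ : IsLIS B′)
         (r : IsLinApprox A A′ R) (s : IsLinApprox B B′ S) where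

  σ-natural : _⨾_ {B = B ⊗ A} (σ A B) (S ⊗ᵣ R) ≐ _⨾_ {B = A′ ⊗ B′} (R ⊗ᵣ S) (σ A′ B′)
  σ-natural (α , β) (β″ , α″) =
    (λ (_ , (a , b) , (s′ , r′)) →
      (α″ , β″) , (AR2 r a r′ (IS2 LA′ α″) , AR2 s b s′ (IS2 LB′ β″)) , (IS2 LA′ α″ , IS2 LB′ β″)) ,
    (λ (_ , (r′ , s′) , (a , b)) →
      (β , α) , (IS2 LA α , IS2 LB β) , (AR2 s (IS2 LB β) s′ b , AR2 r (IS2 LA α) r′ a))

module _ {A A′} {R : Rel A A′} (LA : IsLIS A) (LA′ : IsLIS A′) (r : IsLinApprox A A′ R) where

  ρ-natural : _⨾_ {B = A} (ρ A) R ≐ _⨾_ {B = A′ ⊗ 𝟙} (_⊗ᵣ_ {A} {𝟙} R (idR 𝟙)) (ρ A′)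
  ρ-natural (α , _) α″ =
    (λ (_ , a , r′) → (α″ , tt) , (AR2 r a r′ (IS2 LA′ α″) , tt) , IS2 LA′ α″) ,
    (λ (_ , (r′ , _) , a) → α , IS2 LA α , AR2 r (IS2 LA α) r′ a)

  λ-natural : _⨾_ {B = A} (λ⊗ A) R ≐ _⨾_ {B = 𝟙 ⊗ A′} (_⊗ᵣ_ {𝟙} {A} (idR 𝟙) R) (λ⊗ A′)
  λ-natural (_ , α) α″ =
    (λ (_ , a , r′) → (tt , α″) , (tt , AR2 r a r′ (IS2 LA′ α″)) , IS2 LA′ α″) ,
    (λ (_ , (_ , r′) , a) → α , IS2 LA α , AR2 r (IS2 LA α) r′ a)

module _ {A B C D} (LA : IsLIS A) (LB : IsLIS B) (LC : IsLIS C) (LD : IsLIS D) where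

  φ-pentagon : _⨾_ {B = (A ⊗ B) ⊗ (C ⊗ D)} (φ A B (C ⊗ D)) (φ (A ⊗ B) C D)
                 ≐ _⨾_ {B = (A ⊗ (B ⊗ C)) ⊗ D}
                     (_⨾_ {B = A ⊗ ((B ⊗ C) ⊗ D)}
                        (_⊗ᵣ_ {A} {B ⊗ (C ⊗ D)} (idR A) (φ B C D)) (φ A (B ⊗ C) D))
                     (_⊗ᵣ_ {A ⊗ (B ⊗ C)} {D} (φ A B C) (idR D))
  φ-pentagon (α , (β , (γ , δ))) _ =
    (λ (_ , (a , b , (c , d)) , ((a′ , b′) , c′ , d′)) →
      ((α , (β , γ)) , δ) ,
      ((α , ((β , γ) , δ)) , (IS2 LA α , (IS2 LB β , IS2 LC γ , IS2 LD δ)) ,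
         (IS2 LA α , (IS2 LB β , IS2 LC γ) , IS2 LD δ)) ,
      ((IS3 LA a a′ , IS3 LB b b′ , IS3 LC c c′) , IS3 LD d d′)) ,
    (λ (_ , (_ , (a , (b , c , d)) , (a′ , (b′ , c′) , d′)) , ((a″ , b″ , c″) , d″)) →
      ((α , β) , (γ , δ)) , (IS2 LA α , IS2 LB β , (IS2 LC γ , IS2 LD δ)) ,
      ((IS3 LA a (IS3 LA a′ a″) , IS3 LB b (IS3 LB b′ b″)) ,
        IS3 LC c (IS3 LC c′ c″) , IS3 LD d (IS3 LD d′ d″)))

φ-triangle : ∀ {A B} → IsLIS A → IsLIS B →
             _⊗ᵣ_ {A} {𝟙 ⊗ B} (idR A) (λ⊗ B)
               ≐ _⨾_ {B = (A ⊗ 𝟙) ⊗ B} (φ A 𝟙 B) (_⊗ᵣ_ {A ⊗ 𝟙} {B} (ρ A) (idR B))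
φ-triangle LA LB (α , (_ , β)) _ =
  (λ (a , b) → ((α , tt) , β) , (IS2 LA α , tt , IS2 LB β) , (a , b)) ,
  (λ (_ , (a , _ , b) , (a′ , b′)) → IS3 LA a a′ , IS3 LB b b′)

module _ {A B C} (LA : IsLIS A) (LB : IsLIS B) (LC : IsLIS C) where

  σ-hexagon : _⨾_ {B = C ⊗ (A ⊗ B)} (_⨾_ {B = (A ⊗ B) ⊗ C} (φ A B C) (σ (A ⊗ B) C)) (φ C A B)
                ≐ _⨾_ {B = (A ⊗ C) ⊗ B}
                    (_⨾_ {B = A ⊗ (C ⊗ B)} (_⊗ᵣ_ {A} {B ⊗ C} (idR A) (σ B C)) (φ A C B))
                    (_⊗ᵣ_ {A ⊗ C} {B} (σ A C) (idR B))
  σ-hexagon (α , (β , γ)) _ =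
    (λ (_ , (_ , (a , b , c) , ((a′ , b′) , c′)) , (c″ , a″ , b″)) →
      ((α , γ) , β) ,
      ((α , (γ , β)) , (IS2 LA α , (IS2 LB β , IS2 LC γ)) , (IS2 LA α , IS2 LC γ , IS2 LB β)) ,
      ((IS3 LA a (IS3 LA a′ a″) , IS3 LC c (IS3 LC c′ c″)) , IS3 LB b (IS3 LB b′ b″))) ,
    (λ (_ , (_ , (a , (b , c)) , (a′ , c′ , b′)) , ((a″ , c″) , b″)) →
      (γ , (α , β)) ,
      (((α , β) , γ) , (IS2 LA α , IS2 LB β , IS2 LC γ) , ((IS2 LA α , IS2 LB β) , IS2 LC γ)) ,
      (IS3 LC c (IS3 LC c′ c″) , IS3 LA a (IS3 LA a′ a″) , IS3 LB b (IS3 LB b′ b″)))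

module _ {A B} (LA : IsLIS A) (LB : IsLIS B) where

  Fires : List (Tok A) → Tok A × Tok B → Tok B → Set
  Fires as (α′ , β′) β = (∃[ α ] (α ∈ as × _⊢_ A α α′)) × _⊢_ B β′ β

  -- The consistency of A ⊸ B is applied to the sublist of the pairs that
  -- actually fire; their inputs are consistent because they are entailed by as.
  ⊸-apply-Con : ∀ {fs as bs} → Con (A ⊸ B) fs → Con A as → Covers (Fires as) fs bs → Con B bs
  ⊸-apply-Con {fs} {bs = bs} con-fs con-as cov =
    let (ws , ws⊑fs , bs-covered , ws-used) = Covers-prune fs bs cov
        con-inputs = IS1 LA con-as (Covers-mapʳ {W = _⊢_ A} proj₁ λ w∈ →
          let (_ , _ , (α , α∈ , e) , _) = ws-used w∈ in α , α∈ , e)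
    in IS1 LB (con-fs ws ws⊑fs con-inputs) (Covers-mapˡ proj₂ (Covers-mono proj₂ bs-covered))

  ⊸-isLIS : IsLIS (A ⊸ B)
  ⊸-isLIS = record
    { Con-sing = Con-singleton
    ; IS1 = λ con-fs cov ys ys⊑ con-ys →
        ⊸-apply-Con con-fs con-ys (Covers-mapʳ {W = Fires _} proj₂ λ {y} y∈ →
          let (f , f∈ , a , b) = cov (lookup ys⊑ y∈)
          in f , f∈ , (proj₁ y , ∈-map⁺ proj₁ y∈ , a) , b)
    ; IS2 = λ (α , β) → IS2 LA α , IS2 LB β
    ; IS3 = λ (a , b) (a′ , b′) → IS3 LA a′ a , IS3 LB b b′ }
    where
    Con-singleton : ∀ f ys → ys ⊑ [ f ] → Con A (map proj₁ ys) → Con B (map proj₂ ys)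
    Con-singleton f _ (_ ∷ʳ []) _ = IS1 LB (Con-sing LB (proj₂ f)) (λ ())
    Con-singleton f _ (refl ∷ []) _ = Con-sing LB (proj₂ f)

  ev-isLinApprox : IsLinApprox (A ⊗ (A ⊸ B)) B (ev A B)
  ev-isLinApprox = record
    { AR1 = λ (con-as , con-fs) cov →
        ⊸-apply-Con con-fs con-as (Covers-mapˡ {W = Fires _} proj₂ λ β∈ →
          let (x , x∈ , a , b) = cov β∈ in x , x∈ , (proj₁ x , ∈-map⁺ proj₁ x∈ , a) , b)
    ; AR2 = λ (a , (a′ , b)) (a″ , b′) b″ → IS3 LA a (IS3 LA a″ a′) , IS3 LB b (IS3 LB b′ b″) }

module _ {A B C} {R : Rel (A ⊗ C) B} (LA : IsLIS A) (LC : IsLIS C) where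

  cur-isLinApprox : IsLinApprox (A ⊗ C) B R → IsLinApprox C (A ⊸ B) (cur {A} {B} {C} R)
  cur-isLinApprox r = record
    { AR1 = λ {cs} con-cs cov ys ys⊑ con-ys →
        let (qs , qs-from , qs-to) = Covers-choice {P = Witnesses cs} ys λ {y} y∈ →
              let (γ , γ∈ , r′) = cov (lookup ys⊑ y∈)
              in (proj₁ y , γ) , IS2 LA (proj₁ y) , (γ , γ∈ , IS2 LC γ) , r′
            con-qs = IS1 LA con-ys
                       (Covers-mapˡ proj₁ (Covers-mapʳ proj₁ (Covers-mono proj₁ qs-from)))
                   , IS1 LC con-cs (Covers-mapʳ proj₂ λ q∈ →
                       let (_ , _ , _ , γ-below , _) = qs-from q∈ in γ-below)
        in AR1 r con-qs (Covers-mapʳ proj₂ (Covers-mono (proj₂ ∘ proj₂) qs-to))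
    ; AR2 = λ c r′ (a , b) → AR2 r (a , c) r′ b }
    where
    -- Each output (α , β) is witnessed by (α , γ) with γ ∈ cs and (α , γ) R β;
    -- these pairs form a consistent set of A ⊗ C.
    Witnesses : List (Tok C) → Tok A × Tok B → Tok A × Tok C → Set
    Witnesses cs (α , β) (α′ , γ′) =
      _⊢_ A α α′ × (∃[ γ ] (γ ∈ cs × _⊢_ C γ γ′)) × _∋_ R (α′ , γ′) β

module _ {A B C} {R : Rel (A ⊗ C) B} (LA : IsLIS A) (LB : IsLIS B) (LC : IsLIS C) where

  cur-β : IsLinApprox (A ⊗ C) B R →
          _⨾_ {B = A ⊗ (A ⊸ B)} (_⊗ᵣ_ {A} {C} (idR A) (cur {A} {B} {C} R)) (ev A B) ≐ R
  cur-β r (α , γ) β =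
    (λ (_ , (a , r′) , (a′ , b)) → AR2 r (IS3 LA a a′ , IS2 LC γ) r′ b) ,
    (λ r′ → (α , (α , β)) , (IS2 LA α , r′) , (IS2 LA α , IS2 LB β))

  cur-unique : ∀ {H : Rel C (A ⊸ B)} → IsLinApprox C (A ⊸ B) H →
               _⨾_ {B = A ⊗ (A ⊸ B)} (_⊗ᵣ_ {A} {C} (idR A) H) (ev A B) ≐ R →
               H ≐ cur {A} {B} {C} R
  cur-unique h H⨾ev≐R γ (α , β) =
    (λ h′ → proj₁ (H⨾ev≐R (α , γ) β) ((α , (α , β)) , (IS2 LA α , h′) , (IS2 LA α , IS2 LB β))) ,
    (λ r′ → let (_ , (a , h′) , (a′ , b)) = proj₂ (H⨾ev≐R (α , γ) β) r′
            in AR2 h (IS2 LC γ) h′ (IS3 LA a a′ , b))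

mainTheorem1 : InfLinIsSMCC
mainTheorem1 = record
  { id-mor   = idR-isLinApprox
  ; comp-mor = λ _ LB _ → ⨾-isLinApprox LB
  ; idˡ      = ⨾-identityˡ
  ; idʳ      = ⨾-identityʳ
  ; assoc    = λ {_} {_} {_} {_} {R} {S} {T} _ _ _ _ _ _ _ → ⨾-assoc R S T
  ; ⊗-LIS    = ⊗-isLIS
  ; 𝟙-LIS    = 𝟙-isLIS
  ; ⊗-mor    = λ _ _ _ _ → ⊗ᵣ-isLinApprox
  ; ⊗-id     = λ {A} {B} _ _ → ⊗ᵣ-identity A B
  ; ⊗-comp   = λ {R = R} {R′} {S} {S′} _ _ _ _ _ _ _ _ _ _ → ⊗ᵣ-⨾ R R′ S S′
  ; φ-mor    = φ-isLinApprox
  ; φ-iso    = φ-isIso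
  ; σ-mor    = σ-isLinApprox
  ; σ-iso    = σ-isIso
  ; ρ-mor    = ρ-isLinApprox
  ; ρ-iso    = ρ-isIso
  ; λ-mor    = λ-isLinApprox
  ; λ-iso    = λ-isIso
  ; φ-nat    = φ-natural
  ; σ-nat    = σ-natural
  ; ρ-nat    = ρ-natural
  ; λ-nat    = λ-natural
  ; pentagon = φ-pentagon
  ; triangle = φ-triangle
  ; hexagon  = σ-hexagon
  ; symmetry = σ-involutive
  ; ⊸-LIS    = ⊸-isLIS
  ; ev-mor   = ev-isLinApprox
  ; cur-mor  = λ LA _ LC → cur-isLinApprox LA LC
  ; cur-β    = cur-β
  ; cur-uniq = λ LA LB LC _ → cur-unique LA LB LC
  }
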